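{- Let $(E,+,{}',0,1)$ be an effect algebra whose induced order $\leq$ satisfies the Ascending Chain Condition, and for $x,y\in E$ define the (set-valued) implication $x\rightarrow y:=y+\operatorname{Max}L(x',y')=\{y+z: z\in\operatorname{Max}L(x',y')\}$, and for $A\subseteq E$ put $x\rightarrow A:=\bigcup_{z\in A}(x\rightarrow z)$. Then for all $a,b\in E$: (i) $a\leq b$ if and only if $a\rightarrow b=\{1\}$; (ii) if $a\leq b'$ then $a'\rightarrow b=\{a+b\}$; (iii) if $a\geq b$ then $a\rightarrow b=\{a'+b\}$; (iv) if $a\geq b$ then $a\rightarrow b=b'\rightarrow a'$; (v) $a\rightarrow0=\{a'\}$; (vi) $1\rightarrow a=\{a\}$; (vii) $b'\rightarrow\operatorname{Max}L(a',b')=a\rightarrow b$.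
   Context: An effect algebra is a structure $(E,+,{}',0,1)$ where $E$ is a set, ${}'$ is a unary operation on $E$, $0,1\in E$, and $+$ is a partial binary operation on $E$ such that for all $x,y,z\in E$: (E1) if $x+y$ is defined then so is $y+x$ and $x+y=y+x$; (E2) $(x+y)+z$ is defined if and only if $x+(y+z)$ is defined, and then they are equal; (E3) $x+y$ is defined and equals $1$ if and only if $y=x'$; (E4) if $1+x$ is defined then $x=0$. The induced order is $x\leq y$ iff there exists $z$ with $x+z=y$; it is a partial order with bounds $0,1$. The Ascending Chain Condition means there is no infinite strictly ascending chain in $(E,\leq)$. $L(x,y):=\{z\in E: z\leq x \text{ and } z\leq y\}$ is the lower cone, and $\operatorname{Max}A$ denotes the set of maximal elements of $A\subseteq E$ with respect to $\leq$. (Every element of $\operatorname{Max}L(x',y')$ is $\leq y'$, so $y+z$ is defined for it.) -}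

module Defs where

open import Level using (Level; _⊔_; suc)
open import Data.Nat using (ℕ) renaming (suc to sucℕ)
open import Data.Maybe using (Maybe; just; nothing; _>>=_)
open import Data.Product using (Σ; ∃; _×_; _,_)
open import Relation.Binary.PropositionalEquality using (_≡_)
open import Relation.Nullary using (¬_)

-- An effect algebra (E, +, ′, 0, 1).  The partial operation + is modelled
-- as a total function into Maybe E (nothing = undefined).
record EffectAlgebra (c : Level) : Set (suc c) where
  infixl 6 _⊕_
  field
    Carrier : Set c
    _⊕_     : Carrier → Carrier → Maybe Carrier
    _′      : Carrier → Carrier
    𝟘 𝟙     : Carrier
    E1 : ∀ x y z → x ⊕ y ≡ just z → y ⊕ x ≡ just z
    E2 : ∀ x y z → (x ⊕ y >>= λ s → s ⊕ z) ≡ (y ⊕ z >>= λ t → x ⊕ t)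
    E3-⇒ : ∀ x y → x ⊕ y ≡ just 𝟙 → y ≡ x ′
    E3-⇐ : ∀ x y → y ≡ x ′ → x ⊕ y ≡ just 𝟙
    E4 : ∀ x w → 𝟙 ⊕ x ≡ just w → x ≡ 𝟘

module EA {c : Level} (𝔼 : EffectAlgebra c) where
  open EffectAlgebra 𝔼 public

  Subset : Set (suc c)
  Subset = Carrier → Set c

  _≤_ : Carrier → Carrier → Set c
  x ≤ y = ∃ λ z → x ⊕ z ≡ just y

  _<_ : Carrier → Carrier → Set c
  x < y = x ≤ y × ¬ (x ≡ y)

  ACC : Set c
  ACC = ¬ (Σ (ℕ → Carrier) λ f → ∀ n → f n < f (sucℕ n))

  L : Carrier → Carrier → Subset
  L x y z = z ≤ x × z ≤ y

  Max : Subset → Subset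
  Max A z = A z × (∀ w → A w → z ≤ w → w ≡ z)

  _⇒_ : Carrier → Carrier → Subset
  (x ⇒ y) u = ∃ λ z → Max (L (x ′) (y ′)) z × y ⊕ z ≡ just u

  _⇒ˢ_ : Carrier → Subset → Subset
  (x ⇒ˢ A) u = ∃ λ z → A z × (x ⇒ z) u

  ⟦_⟧ : Carrier → Subset
  ⟦ a ⟧ u = u ≡ a

  _≐_ : Subset → Subset → Set c
  A ≐ B = (∀ u → A u → B u) × (∀ u → B u → A u)

-- For comparable x and y the lower cone L(x, y) has the smaller element as its
-- unique maximal element, so x → y collapses to the singleton of one sum.
-- Items (i)-(vi) reduce to this, using that ′ is an order-reversing involution
-- (a ≤ b′ iff b ≤ a′) and that a ≤ b′ makes a + b defined.  Item (vii) holds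
-- pointwise: each z ∈ Max L(a′, b′) has b ≤ z′, hence b′ → z = {b + z}.
module Submission where

open import Defs
open import Level using (Level)
open import Data.Maybe using (Maybe; just; nothing; _>>=_)
open import Data.Maybe.Properties using (just-injective)
open import Data.Product using (_×_; ∃; _,_)
open import Relation.Binary.PropositionalEquality
  using (_≡_; refl; sym; trans; subst; cong)
open import Function.Base using (_∘_)
open import Function.Bundles using (_⇔_; mk⇔)

>>=-just-inv : ∀ {a} {A B : Set a} (m : Maybe A) (f : A → Maybe B) {r : B} →
               (m >>= f) ≡ just r → ∃ λ t → m ≡ just t × f t ≡ just r
>>=-just-inv (just t) f e = t , refl , e
>>=-just-inv nothing  f ()

module Properties {c : Level} (𝔼 : EffectAlgebra c) where
  open EA 𝔼

  ⊕-assocʳ : ∀ {x y z s r} → x ⊕ y ≡ just s → s ⊕ z ≡ just r →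
             ∃ λ t → y ⊕ z ≡ just t × x ⊕ t ≡ just r
  ⊕-assocʳ {x} {y} {z} p q = >>=-just-inv (y ⊕ z) (x ⊕_)
    (trans (sym (E2 x y z)) (trans (cong (_>>= λ s → s ⊕ z) p) q))

  ⊕-assocˡ : ∀ {x y z t r} → y ⊕ z ≡ just t → x ⊕ t ≡ just r →
             ∃ λ s → x ⊕ y ≡ just s × s ⊕ z ≡ just r
  ⊕-assocˡ {x} {y} {z} p q = >>=-just-inv (x ⊕ y) (_⊕ z)
    (trans (E2 x y z) (trans (cong (_>>= x ⊕_) p) q))

  ⊕-inverseʳ : ∀ x → x ⊕ x ′ ≡ just 𝟙
  ⊕-inverseʳ x = E3-⇐ x (x ′) refl

  ⊕-functional : ∀ {x y s t} → x ⊕ y ≡ just s → x ⊕ y ≡ just t → s ≡ t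
  ⊕-functional p q = just-injective (trans (sym p) q)

  ′-involutive : ∀ x → x ′ ′ ≡ x
  ′-involutive x = sym (E3-⇒ (x ′) x (E1 _ _ _ (⊕-inverseʳ x)))

  𝟙′≡𝟘 : 𝟙 ′ ≡ 𝟘
  𝟙′≡𝟘 = E4 (𝟙 ′) 𝟙 (⊕-inverseʳ 𝟙)

  ⊕-identityʳ : ∀ x → x ⊕ 𝟘 ≡ just x
  ⊕-identityʳ x = subst (λ v → v ⊕ 𝟘 ≡ just v) (′-involutive x) (′-identity (x ′))
    where
    ′-identity : ∀ y → y ′ ⊕ 𝟘 ≡ just (y ′)
    ′-identity y with ⊕-assocʳ (⊕-inverseʳ y)
                        (subst (λ v → 𝟙 ⊕ v ≡ just 𝟙) 𝟙′≡𝟘 (⊕-inverseʳ 𝟙))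
    ... | t , y′⊕𝟘≡t , y⊕t≡𝟙 = subst (λ v → y ′ ⊕ 𝟘 ≡ just v) (E3-⇒ y t y⊕t≡𝟙) y′⊕𝟘≡t

  ⊕-identityˡ : ∀ x → 𝟘 ⊕ x ≡ just x
  ⊕-identityˡ x = E1 _ _ _ (⊕-identityʳ x)

  ⊕-cancel-𝟘 : ∀ {a x} → a ⊕ x ≡ just a → x ≡ 𝟘
  ⊕-cancel-𝟘 {a} {x} a⊕x≡a with ⊕-assocʳ (E1 _ _ _ a⊕x≡a) (⊕-inverseʳ a)
  ... | t , a⊕a′≡t , x⊕t≡𝟙 =
    E4 x _ (E1 _ _ _ (subst (λ v → x ⊕ v ≡ just 𝟙) (⊕-functional a⊕a′≡t (⊕-inverseʳ a)) x⊕t≡𝟙))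

  ⊕-zero-sum : ∀ {x y} → x ⊕ y ≡ just 𝟘 → x ≡ 𝟘
  ⊕-zero-sum {x} {y} x⊕y≡𝟘 with ⊕-assocʳ x⊕y≡𝟘 (⊕-identityˡ 𝟙)
  ... | t , y⊕𝟙≡t , _ with E4 y t (E1 _ _ _ y⊕𝟙≡t)
  ... | refl = ⊕-functional (⊕-identityʳ x) x⊕y≡𝟘

  ⊕-definedˡ : ∀ {x y z s r} → x ⊕ y ≡ just s → s ⊕ z ≡ just r → ∃ λ t → x ⊕ z ≡ just t
  ⊕-definedˡ p q with ⊕-assocʳ p q
  ... | t , y⊕z≡t , x⊕t≡r with ⊕-assocˡ (E1 _ _ _ y⊕z≡t) x⊕t≡r
  ... | s , x⊕z≡s , _ = s , x⊕z≡s

  ≤-refl : ∀ x → x ≤ x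
  ≤-refl x = 𝟘 , ⊕-identityʳ x

  ≤-antisym : ∀ {x y} → x ≤ y → y ≤ x → x ≡ y
  ≤-antisym {x} (w , x⊕w≡y) (v , y⊕v≡x) with ⊕-assocʳ x⊕w≡y y⊕v≡x
  ... | t , w⊕v≡t , x⊕t≡x with ⊕-cancel-𝟘 x⊕t≡x
  ... | refl with ⊕-zero-sum w⊕v≡t
  ... | refl = ⊕-functional (⊕-identityʳ x) x⊕w≡y

  𝟘-≤ : ∀ x → 𝟘 ≤ x
  𝟘-≤ x = x , ⊕-identityˡ x

  ≤-𝟙 : ∀ x → x ≤ 𝟙
  ≤-𝟙 x = x ′ , ⊕-inverseʳ x

  ′-antitone : ∀ {x y} → x ≤ y → (y ′) ≤ (x ′)
  ′-antitone {x} {y} (w , x⊕w≡y) with ⊕-assocʳ x⊕w≡y (⊕-inverseʳ y)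
  ... | t , w⊕y′≡t , x⊕t≡𝟙 =
    w , subst (λ v → y ′ ⊕ w ≡ just v) (E3-⇒ x t x⊕t≡𝟙) (E1 _ _ _ w⊕y′≡t)

  ≤′-swap : ∀ {x y} → x ≤ (y ′) → y ≤ (x ′)
  ≤′-swap {x} {y} x≤y′ = subst (_≤ (x ′)) (′-involutive y) (′-antitone x≤y′)

  ′-reflects-≤ : ∀ {x y} → (x ′) ≤ (y ′) → y ≤ x
  ′-reflects-≤ {x} x′≤y′ = subst (_ ≤_) (′-involutive x) (≤′-swap x′≤y′)

  ⊕-defined-≤′ : ∀ {x y} → x ≤ (y ′) → ∃ λ s → x ⊕ y ≡ just s
  ⊕-defined-≤′ {y = y} (w , x⊕w≡y′) = ⊕-definedˡ x⊕w≡y′ (E1 _ _ _ (⊕-inverseʳ y))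

  ≐-sym : ∀ {A B : Subset} → A ≐ B → B ≐ A
  ≐-sym (A⊆B , B⊆A) = B⊆A , A⊆B

  ≐-trans : ∀ {A B C : Subset} → A ≐ B → B ≐ C → A ≐ C
  ≐-trans (A⊆B , B⊆A) (B⊆C , C⊆B) = (λ u → B⊆C u ∘ A⊆B u) , (λ u → B⊆A u ∘ C⊆B u)

  ⟦⟧-cong : ∀ {x y} → x ≡ y → ⟦ x ⟧ ≐ ⟦ y ⟧
  ⟦⟧-cong x≡y = (λ u u≡x → trans u≡x x≡y) , (λ u u≡y → trans u≡y (sym x≡y))

  Max-L-≤ˡ : ∀ {x y} → x ≤ y → Max (L x y) ≐ ⟦ x ⟧
  Max-L-≤ˡ {x} x≤y =
      (λ z ((z≤x , _) , maximal) → sym (maximal x (≤-refl x , x≤y) z≤x))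
    , (λ { z refl → (≤-refl x , x≤y) , λ w (w≤x , _) x≤w → ≤-antisym w≤x x≤w })

  Max-L-≤ʳ : ∀ {x y} → y ≤ x → Max (L x y) ≐ ⟦ y ⟧
  Max-L-≤ʳ y≤x = ≐-trans Max-L-comm (Max-L-≤ˡ y≤x)
    where
    Max-L-comm : ∀ {x y} → Max (L x y) ≐ Max (L y x)
    Max-L-comm =
        (λ z ((z≤x , z≤y) , maximal) → (z≤y , z≤x) , λ w (w≤y , w≤x) → maximal w (w≤x , w≤y))
      , (λ z ((z≤y , z≤x) , maximal) → (z≤x , z≤y) , λ w (w≤x , w≤y) → maximal w (w≤y , w≤x))

  ⇒-singleton : ∀ {x y z s} → Max (L (x ′) (y ′)) ≐ ⟦ z ⟧ → y ⊕ z ≡ just s → (x ⇒ y) ≐ ⟦ s ⟧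
  ⇒-singleton {s = s} (Max⊆⟦z⟧ , ⟦z⟧⊆Max) y⊕z≡s =
      (λ { u (z′ , z′-max , y⊕z′≡u) → ⊕-functional y⊕z′≡u
             (subst (λ v → _ ⊕ v ≡ just s) (sym (Max⊆⟦z⟧ z′ z′-max)) y⊕z≡s) })
    , (λ { u refl → _ , ⟦z⟧⊆Max _ refl , y⊕z≡s })

  ≤⇔⇒≐𝟙 : ∀ a b → (a ≤ b) ⇔ ((a ⇒ b) ≐ ⟦ 𝟙 ⟧)
  ≤⇔⇒≐𝟙 a b = mk⇔ to from
    where
    to : a ≤ b → (a ⇒ b) ≐ ⟦ 𝟙 ⟧
    to a≤b = ⇒-singleton (Max-L-≤ʳ (′-antitone a≤b)) (⊕-inverseʳ b)
    from : (a ⇒ b) ≐ ⟦ 𝟙 ⟧ → a ≤ b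
    from (_ , 𝟙∈a⇒b) with 𝟙∈a⇒b 𝟙 refl
    ... | z , ((z≤a′ , _) , _) , b⊕z≡𝟙 = ′-reflects-≤ (subst (_≤ (a ′)) (E3-⇒ b z b⊕z≡𝟙) z≤a′)

  ′⇒-≤′ : ∀ a b → a ≤ (b ′) → ∃ λ s → a ⊕ b ≡ just s × (((a ′) ⇒ b) ≐ ⟦ s ⟧)
  ′⇒-≤′ a b a≤b′ with ⊕-defined-≤′ a≤b′
  ... | s , a⊕b≡s = s , a⊕b≡s , ⇒-singleton Max-L≐⟦a⟧ (E1 _ _ _ a⊕b≡s)
    where
    Max-L≐⟦a⟧ : Max (L (a ′ ′) (b ′)) ≐ ⟦ a ⟧
    Max-L≐⟦a⟧ = ≐-trans (Max-L-≤ˡ (subst (_≤ (b ′)) (sym (′-involutive a)) a≤b′))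
                        (⟦⟧-cong (′-involutive a))

  ⇒-≥ : ∀ a b → b ≤ a → ∃ λ s → (a ′) ⊕ b ≡ just s × ((a ⇒ b) ≐ ⟦ s ⟧)
  ⇒-≥ a b b≤a with ⊕-defined-≤′ (subst (b ≤_) (sym (′-involutive a)) b≤a)
  ... | s , b⊕a′≡s = s , E1 _ _ _ b⊕a′≡s , ⇒-singleton (Max-L-≤ˡ (′-antitone b≤a)) b⊕a′≡s

  ⇒-contrapositive : ∀ a b → b ≤ a → (a ⇒ b) ≐ ((b ′) ⇒ (a ′))
  ⇒-contrapositive a b b≤a with ⇒-≥ a b b≤a | ′⇒-≤′ b (a ′) (subst (b ≤_) (sym (′-involutive a)) b≤a)
  ... | s , a′⊕b≡s , a⇒b≐⟦s⟧ | t , b⊕a′≡t , b′⇒a′≐⟦t⟧ =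
    ≐-trans a⇒b≐⟦s⟧ (≐-trans (⟦⟧-cong (⊕-functional a′⊕b≡s (E1 _ _ _ b⊕a′≡t))) (≐-sym b′⇒a′≐⟦t⟧))

  ⇒-𝟘 : ∀ a → (a ⇒ 𝟘) ≐ ⟦ a ′ ⟧
  ⇒-𝟘 a = ⇒-singleton (Max-L-≤ˡ (′-antitone (𝟘-≤ a))) (⊕-identityˡ (a ′))

  𝟙-⇒ : ∀ a → (𝟙 ⇒ a) ≐ ⟦ a ⟧
  𝟙-⇒ a = ⇒-singleton (≐-trans (Max-L-≤ˡ (′-antitone (≤-𝟙 a))) (⟦⟧-cong 𝟙′≡𝟘)) (⊕-identityʳ a)

  ′⇒ˢ-Max-L : ∀ a b → ((b ′) ⇒ˢ Max (L (a ′) (b ′))) ≐ (a ⇒ b)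
  ′⇒ˢ-Max-L a b = ⊆ , ⊇
    where
    b′⇒z≐⟦b⊕z⟧ : ∀ {z} → Max (L (a ′) (b ′)) z →
                  ∃ λ s → b ⊕ z ≡ just s × (((b ′) ⇒ z) ≐ ⟦ s ⟧)
    b′⇒z≐⟦b⊕z⟧ ((_ , z≤b′) , _) = ′⇒-≤′ b _ (≤′-swap z≤b′)
    ⊆ : ∀ u → ((b ′) ⇒ˢ Max (L (a ′) (b ′))) u → (a ⇒ b) u
    ⊆ u (z , z-max , u∈b′⇒z) with b′⇒z≐⟦b⊕z⟧ z-max
    ... | s , b⊕z≡s , (b′⇒z⊆⟦s⟧ , _) with b′⇒z⊆⟦s⟧ u u∈b′⇒z
    ... | refl = z , z-max , b⊕z≡s
    ⊇ : ∀ u → (a ⇒ b) u → ((b ′) ⇒ˢ Max (L (a ′) (b ′))) u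
    ⊇ u (z , z-max , b⊕z≡u) with b′⇒z≐⟦b⊕z⟧ z-max
    ... | s , b⊕z≡s , (_ , ⟦s⟧⊆b′⇒z) with ⊕-functional b⊕z≡s b⊕z≡u
    ... | refl = z , z-max , ⟦s⟧⊆b′⇒z u refl

theorem5p1 : ∀ {c : Level} (𝔼 : EffectAlgebra c) → let open EA 𝔼 in
    ACC → ∀ a b →
      ((a ≤ b) ⇔ ((a ⇒ b) ≐ ⟦ 𝟙 ⟧))
      × (a ≤ (b ′) → ∃ λ s → a ⊕ b ≡ just s × (((a ′) ⇒ b) ≐ ⟦ s ⟧))
      × (b ≤ a → ∃ λ s → (a ′) ⊕ b ≡ just s × ((a ⇒ b) ≐ ⟦ s ⟧))
      × (b ≤ a → (a ⇒ b) ≐ ((b ′) ⇒ (a ′)))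
      × ((a ⇒ 𝟘) ≐ ⟦ a ′ ⟧)
      × ((𝟙 ⇒ a) ≐ ⟦ a ⟧)
      × (((b ′) ⇒ˢ Max (L (a ′) (b ′))) ≐ (a ⇒ b))
theorem5p1 𝔼 _ a b =
    ≤⇔⇒≐𝟙 a b , ′⇒-≤′ a b , ⇒-≥ a b , ⇒-contrapositive a b , ⇒-𝟘 a , 𝟙-⇒ a , ′⇒ˢ-Max-L a b
  where open Properties 𝔼
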